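{- Let $k\geq 1$ and let $G=G_k$ be the graph defined below. Let $(\mathcal{A},\mathcal{B})$ be a rectangle in $G$ that contains at least one canonical solution $I_\rho$. Then $\mathcal{A}$ contains at most one useful set or $\mathcal{B}$ contains at most one useful set.
   Context: Construction of $G_k$: let $q=4\binom{k}{2}$. A 2-clause is a tuple $(a,b,n^a,n^b)$ where $\{a,b\}$ is an unordered pair of distinct elements of $[k]$ and $n^a,n^b\in\{0,1\}$; there are exactly $q$ of them. Fix an enumeration $w_1,\dots,w_q$ where $w_i$ corresponds to the clause $(a_i,b_i,n^a_i,n^b_i)$. The vertex set is $\{v_{i,j}: i\in[k], j\in\{0,\dots,2q-1\}\}\cup\{w_j: j\in[q]\}$. The edges are $v_{i,j-1}v_{i,j}$ for all $i\in[k]$, $j\in[2q-1]$, together with, for every $i\in[q]$, the two edges $w_i v_{a_i,2(i-1)+n^a_i}$ and $w_i v_{b_i,2(i-1)+n^b_i}$. For an assignment $\rho:[k]\to\{0,1\}$, the canonical solution is $I_\rho=\{v_{i,2j+\rho(i)}: i\in[k], j\in\{0,\dots,q-1\}\}\cup\{w_i: \rho(a_i)\neq n^a_i \text{ and } \rho(b_i)\neq n^b_i\}$ (an independent set of $G$). A pair $\mathcal{A},\mathcal{B}$ of families of independent sets of $G$ is a rectangle in $G$ if for all $A\in\mathcal{A}$, $B\in\mathcal{B}$, the sets $A$ and $B$ are disjoint and there is no edge of $G$ between $A$ and $B$. The rectangle contains an independent set $I$ if $I=A\cup B$ for some $A\in\mathcal{A}$, $B\in\mathcal{B}$. A set $A\in\mathcal{A}$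 is useful if there is $B\in\mathcal{B}$ with $A\cup B$ a canonical solution (for some assignment); usefulness of $B\in\mathcal{B}$ is defined symmetrically. -}

module Defs where

open import Data.Nat as ℕ using (ℕ; suc; _+_; _*_)
open import Data.Nat.Combinatorics using (_C_)
open import Data.Bool using (Bool; true; false)
open import Data.Fin as Fin using (Fin; toℕ; combine; _↑ˡ_; _↑ʳ_)
open import Data.Fin.Subset using (Subset; _∈_; _∪_)
open import Data.Product using (Σ; ∃; ∃-syntax; _×_; _,_)
open import Data.Sum using (_⊎_)
open import Data.Empty using (⊥)
open import Relation.Binary.PropositionalEquality using (_≡_; _≢_)
open import Relation.Nullary using (¬_)

b2n : Bool → ℕ
b2n false = 0
b2n true  = 1

q : ℕ → ℕ
q k = 4 * (k C 2)

-- A 2-clause (a, b, n^a, n^b), {a,b} an unordered pair of distinct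
-- elements of [k]; represented canonically with a < b.
record Clause (k : ℕ) : Set where
  constructor clause
  field
    a   : Fin k
    b   : Fin k
    a<b : a Fin.< b
    na  : Bool
    nb  : Bool

-- The graph G_k, for a fixed enumeration  enum : Fin q → Clause k
-- (w_{c+1} ↔ enum c, 0-indexed).  Vertices are Fin (N k):
-- v_{i,j} ↦ vv i j,  w_{c+1} ↦ ww c.
N : ℕ → ℕ
N k = k * (2 * q k) + q k

module G (k : ℕ) (enum : Fin (q k) → Clause k) where

  V : Set
  V = Fin (N k)

  vv : Fin k → Fin (2 * q k) → V
  vv i j = combine i j ↑ˡ q k

  ww : Fin (q k) → V
  ww c = (k * (2 * q k)) ↑ʳ c

  open Clause

  -- (directed presentation of the) edges of G_k
  data Edge : V → V → Set where
    path : (i : Fin k) (j j′ : Fin (2 * q k)) → toℕ j′ ≡ suc (toℕ j) →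
           Edge (vv i j) (vv i j′)
    edgeA : (c : Fin (q k)) (j : Fin (2 * q k)) →
            toℕ j ≡ 2 * toℕ c + b2n (na (enum c)) →
            Edge (ww c) (vv (a (enum c)) j)
    edgeB : (c : Fin (q k)) (j : Fin (2 * q k)) →
            toℕ j ≡ 2 * toℕ c + b2n (nb (enum c)) →
            Edge (ww c) (vv (b (enum c)) j)

  Adj : V → V → Set
  Adj x y = Edge x y ⊎ Edge y x

  VSet : Set
  VSet = Subset (N k)

  Independent : VSet → Set
  Independent S = ∀ x y → x ∈ S → y ∈ S → ¬ Adj x y

  Family : Set
  Family = VSet → Bool

  _∈F_ : VSet → Family → Set
  S ∈F 𝓕 = 𝓕 S ≡ true

  data InCanon (ρ : Fin k → Bool) : V → Set where
    inV : (i : Fin k) (j : Fin (2 * q k)) (m : ℕ) →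
          toℕ j ≡ 2 * m + b2n (ρ i) → InCanon ρ (vv i j)
    inW : (c : Fin (q k)) → ρ (a (enum c)) ≢ na (enum c) →
          ρ (b (enum c)) ≢ nb (enum c) → InCanon ρ (ww c)

  IsCanonical : (Fin k → Bool) → VSet → Set
  IsCanonical ρ I = ∀ x → (x ∈ I → InCanon ρ x) × (InCanon ρ x → x ∈ I)

  Rectangle : Family → Family → Set
  Rectangle 𝒜 ℬ =
    (∀ A → A ∈F 𝒜 → Independent A) ×
    (∀ B → B ∈F ℬ → Independent B) ×
    (∀ A B → A ∈F 𝒜 → B ∈F ℬ →
       (∀ x → x ∈ A → x ∈ B → ⊥) ×
       (∀ x y → x ∈ A → y ∈ B → ¬ Adj x y))

  Contains : Family → Family → VSet → Set
  Contains 𝒜 ℬ I = ∃[ A ] ∃[ B ] (A ∈F 𝒜 × B ∈F ℬ × A ∪ B ≡ I)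

  UsefulA : Family → Family → VSet → Set
  UsefulA 𝒜 ℬ A = A ∈F 𝒜 × ∃[ B ] (B ∈F ℬ × ∃[ ρ ] IsCanonical ρ (A ∪ B))

  UsefulB : Family → Family → VSet → Set
  UsefulB 𝒜 ℬ B = B ∈F ℬ × ∃[ A ] (A ∈F 𝒜 × ∃[ ρ ] IsCanonical ρ (A ∪ B))

  AtMostOne : (VSet → Set) → Set
  AtMostOne P = ∀ S T → P S → P T → S ≡ T

-- Fix a rectangle (𝒜, ℬ) containing I_ρ = A ∪ B, and call row i the path v_{i,0} … v_{i,2q-1}.
-- Say that a family 𝒴 guards row i if some set of 𝒴 contains a clause vertex w_c whose clause
-- mentions i. If ℬ guards every row then 𝒜 has at most one useful set: take useful X₁, X₂ ∈ 𝒜,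
-- completed by Y₁, Y₂ ∈ ℬ to canonical solutions for τ₁, τ₂. On a row where τ₁ and τ₂ differ,
-- every vertex lies in X₁ ∪ Y₁ ∪ X₂ ∪ Y₂ by parity; since no edge joins the 𝒜-side to the
-- ℬ-side and the row is connected, the row lies entirely on one side, and the guard (which is
-- on the ℬ-side and adjacent to the row) forces the ℬ-side. Hence X₁ and X₂ contain no vertex
-- of such a row. Every vertex of X₁ therefore belongs to I_τ₂ = X₂ ∪ Y₂ (for a clause vertex, a
-- literal true under τ₂ would put its neighbour into Y₂, or into X₂ on a disagreeing row), and
-- X₁ ∩ Y₂ = ∅, so X₁ ⊆ X₂. Symmetrically with 𝒜 and ℬ exchanged.
-- Finally one of the two families guards every row: if A does not guard row y₀, then for any
-- x ≠ y₀ the clause (x, y₀, ¬ρ(x), ¬ρ(y₀)) has its vertex in I_ρ but not in A, so in B,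
-- and B guards both x and y₀.
module Submission where

open import Defs
open import Data.Nat using (ℕ; zero; suc; _≤_; _+_; _*_; z≤n; s≤s)
import Data.Nat as ℕ
open import Data.Nat.Properties using (+-suc; +-monoʳ-≤; *-monoʳ-≤; ≤-trans; ≤-reflexive)
open import Data.Nat.Tactic.RingSolver using (solve-∀)
open import Data.Fin using (Fin; toℕ; fromℕ<; inject₁; punchIn; _<_; _≟_)
import Data.Fin as Fin
open import Data.Fin.Properties using (toℕ-fromℕ<; toℕ<n; toℕ-inject₁; <-cmp; any?; all?; ¬∀⟶∃¬; punchInᵢ≢i)
open import Data.Fin.Induction using (<-weakInduction)
open import Data.Fin.Subset using (_∈_; _∪_; _⊆_)
open import Data.Fin.Subset.Properties using (x∈p∪q⁻; x∈p∪q⁺; ∪-comm; ⊆-antisym; _∈?_)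
open import Data.Bool using (Bool; true; false; not)
open import Data.Bool.Properties using (¬-not; not-¬)
import Data.Bool.Properties as Bool
open import Data.Product using (∃-syntax; _×_; _,_; proj₁; proj₂)
open import Data.Sum using (_⊎_; inj₁; inj₂; swap) renaming (map to ⊎-map)
open import Data.Empty using (⊥; ⊥-elim)
open import Data.Vec using ([])
open import Function using (id; _∘_)
open import Function.Definitions using (Bijective; Surjective)
open import Relation.Binary.PropositionalEquality
open import Relation.Binary.Definitions using (tri<; tri≈; tri>)
open import Relation.Nullary using (¬_; Dec; yes; no)
open import Relation.Nullary.Decidable using (_×-dec_; _⊎-dec_)

≢⇒≡⊎≡ : ∀ {x y} b → x ≢ y → b ≡ x ⊎ b ≡ y
≢⇒≡⊎≡ {x} b x≢y with b Bool.≟ x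
... | yes b≡x = inj₁ b≡x
... | no b≢x = inj₂ (trans (¬-not b≢x) (sym (¬-not (x≢y ∘ sym))))

even-or-odd : ∀ n → ∃[ m ] ∃[ b ] n ≡ 2 * m + b2n b
even-or-odd zero = 0 , false , refl
even-or-odd (suc n) with even-or-odd n
... | m , false , refl = m , true , sym (+-suc (2 * m) 0)
... | m , true , refl = suc m , false , carry m
  where
  carry : ∀ m → suc (2 * m + 1) ≡ 2 * suc m + 0
  carry = solve-∀

2*m+b2n<2*n : ∀ {m n} b → m ℕ.< n → 2 * m + b2n b ℕ.< 2 * n
2*m+b2n<2*n {m} b m<n =
  ≤-trans (s≤s (+-monoʳ-≤ (2 * m) (b2n≤1 b))) (≤-trans (≤-reflexive (carry m)) (*-monoʳ-≤ 2 m<n))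
  where
  b2n≤1 : ∀ b → b2n b ≤ 1
  b2n≤1 false = z≤n
  b2n≤1 true = s≤s z≤n
  carry : ∀ m → suc (2 * m + 1) ≡ 2 * suc m
  carry = solve-∀

another : ∀ {n} (y : Fin (suc (suc n))) → ∃[ x ] x ≢ y
another y = punchIn y Fin.zero , punchInᵢ≢i y Fin.zero

Fin-spread : ∀ {n} (R : Fin n → Set) →
             (∀ {i j} → toℕ j ≡ suc (toℕ i) → R i → R j) →
             (∀ {i j} → toℕ j ≡ suc (toℕ i) → R j → R i) →
             ∀ {i} → R i → ∀ j → R j
Fin-spread {suc n} R forward backward {i} Rᵢ = <-weakInduction R (reaches-zero i Rᵢ) (λ j → forward (next j))
  where
  next : ∀ j → toℕ (Fin.suc j) ≡ suc (toℕ (inject₁ j))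
  next j = cong suc (sym (toℕ-inject₁ j))
  reaches-zero : ∀ i → R i → R Fin.zero
  reaches-zero = <-weakInduction (λ i → R i → R Fin.zero) id (λ j back → back ∘ backward (next j))

module _ (k : ℕ) (enum : Fin (q k) → Clause k) where
  open G k enum
  open Clause

  Occurs : Fin (q k) → Fin k → Set
  Occurs c i = a (enum c) ≡ i ⊎ b (enum c) ≡ i

  RowGuardedBy : VSet → Fin k → Set
  RowGuardedBy W i = ∃[ c ] (ww c ∈ W × Occurs c i)

  RowsGuardedBy : Family → Set
  RowsGuardedBy 𝒴 = ∀ i → ∃[ W ] (W ∈F 𝒴 × RowGuardedBy W i)

  Separated : Family → Family → Set
  Separated 𝒳 𝒴 = ∀ X Y → X ∈F 𝒳 → Y ∈F 𝒴 →
                  (∀ x → x ∈ X → x ∈ Y → ⊥) × (∀ x y → x ∈ X → y ∈ Y → ¬ Adj x y)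

  Useful : Family → Family → VSet → Set
  Useful 𝒳 𝒴 X = X ∈F 𝒳 × ∃[ Y ] (Y ∈F 𝒴 × ∃[ τ ] IsCanonical τ (X ∪ Y))

  UsefulB⇒Useful : ∀ {𝒜 ℬ B} → UsefulB 𝒜 ℬ B → Useful ℬ 𝒜 B
  UsefulB⇒Useful {B = B} (B∈ , A , A∈ , τ , can) = B∈ , A , A∈ , τ , subst (IsCanonical τ) (∪-comm A B) can

  at-most-one-UsefulB : ∀ {𝒜 ℬ} → AtMostOne (Useful ℬ 𝒜) → AtMostOne (UsefulB 𝒜 ℬ)
  at-most-one-UsefulB {𝒜} {ℬ} unique S T S-useful T-useful =
    unique S T (UsefulB⇒Useful {𝒜} {ℬ} S-useful) (UsefulB⇒Useful {𝒜} {ℬ} T-useful)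

  Adj-sym : ∀ {x y} → Adj x y → Adj y x
  Adj-sym = swap

  Separated-sym : ∀ {𝒳 𝒴} → Separated 𝒳 𝒴 → Separated 𝒴 𝒳
  Separated-sym sep Y X Y∈ X∈ =
    (λ x x∈Y x∈X → proj₁ (sep X Y X∈ Y∈) x x∈X x∈Y) ,
    (λ y x y∈Y x∈X → proj₂ (sep X Y X∈ Y∈) x y x∈X y∈Y ∘ Adj-sym)

  slot : Fin (q k) → Bool → Fin (2 * q k)
  slot c n = fromℕ< (2*m+b2n<2*n n (toℕ<n c))

  toℕ-slot : ∀ c n → toℕ (slot c n) ≡ 2 * toℕ c + b2n n
  toℕ-slot c n = toℕ-fromℕ< _

  occurrence-adjacent : ∀ {c i} → Occurs c i → ∃[ j ] Adj (ww c) (vv i j)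
  occurrence-adjacent {c} (inj₁ refl) = slot c (na (enum c)) , inj₁ (edgeA c _ (toℕ-slot c _))
  occurrence-adjacent {c} (inj₂ refl) = slot c (nb (enum c)) , inj₁ (edgeB c _ (toℕ-slot c _))

  canonical-row : ∀ {τ S i j} → IsCanonical τ S → ∀ m → toℕ j ≡ 2 * m + b2n (τ i) → vv i j ∈ S
  canonical-row {i = i} {j} can m e = proj₂ (can (vv i j)) (inV i j m e)

  row-covered : ∀ {τ₁ τ₂ S₁ S₂ i} → τ₁ i ≢ τ₂ i → IsCanonical τ₁ S₁ → IsCanonical τ₂ S₂ →
                ∀ j → vv i j ∈ S₁ ⊎ vv i j ∈ S₂
  row-covered τ≢ can₁ can₂ j with even-or-odd (toℕ j)
  ... | m , parity , e with ≢⇒≡⊎≡ parity τ≢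
  ... | inj₁ refl = inj₁ (canonical-row can₁ m e)
  ... | inj₂ refl = inj₂ (canonical-row can₂ m e)

  row-confined : ∀ (P Q : V → Set) {i j₀} → (∀ {x y} → P x → Q y → ¬ Adj x y) →
                 (∀ j → P (vv i j) ⊎ Q (vv i j)) → P (vv i j₀) → ∀ j → P (vv i j)
  row-confined P Q {i} apart covered = Fin-spread (P ∘ vv i)
    (λ {j} {j′} e Pj → cross (inj₁ (path i j j′ e)) Pj (covered j′))
    (λ {j} {j′} e Pj′ → cross (inj₂ (path i j j′ e)) Pj′ (covered j))
    where
    cross : ∀ {x y} → Adj x y → P x → P y ⊎ Q y → P y
    cross _ _ (inj₁ Py) = Py
    cross adj Px (inj₂ Qy) = ⊥-elim (apart Px Qy adj)

  module _ {𝒳 𝒴 : Family} (sep : Separated 𝒳 𝒴) (guarded : RowsGuardedBy 𝒴) where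

    private
      disjoint : ∀ {X Y x} → X ∈F 𝒳 → Y ∈F 𝒴 → x ∈ X → x ∈ Y → ⊥
      disjoint X∈ Y∈ = proj₁ (sep _ _ X∈ Y∈) _

      apart : ∀ {X Y x y} → X ∈F 𝒳 → Y ∈F 𝒴 → x ∈ X → y ∈ Y → ¬ Adj x y
      apart X∈ Y∈ = proj₂ (sep _ _ X∈ Y∈) _ _

    module _ {X₁ Y₁ X₂ Y₂ τ₁ τ₂} (X₁∈ : X₁ ∈F 𝒳) (Y₁∈ : Y₁ ∈F 𝒴) (can₁ : IsCanonical τ₁ (X₁ ∪ Y₁))
                                 (X₂∈ : X₂ ∈F 𝒳) (Y₂∈ : Y₂ ∈F 𝒴) (can₂ : IsCanonical τ₂ (X₂ ∪ Y₂)) where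

      private
        OnX OnY : V → Set
        OnX v = v ∈ X₁ ⊎ v ∈ X₂
        OnY v = v ∈ Y₁ ⊎ v ∈ Y₂

        OnX-apart : ∀ {W x y} → W ∈F 𝒴 → OnX x → y ∈ W → ¬ Adj x y
        OnX-apart W∈ (inj₁ x∈) = apart X₁∈ W∈ x∈
        OnX-apart W∈ (inj₂ x∈) = apart X₂∈ W∈ x∈

        OnX-apart-OnY : ∀ {x y} → OnX x → OnY y → ¬ Adj x y
        OnX-apart-OnY x∈ (inj₁ y∈) = OnX-apart Y₁∈ x∈ y∈
        OnX-apart-OnY x∈ (inj₂ y∈) = OnX-apart Y₂∈ x∈ y∈

        disagreeing-row-covered : ∀ {i} → τ₁ i ≢ τ₂ i → ∀ j → OnX (vv i j) ⊎ OnY (vv i j)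
        disagreeing-row-covered τ≢ j with row-covered τ≢ can₁ can₂ j
        ... | inj₁ in₁ = ⊎-map inj₁ inj₁ (x∈p∪q⁻ X₁ Y₁ in₁)
        ... | inj₂ in₂ = ⊎-map inj₂ inj₂ (x∈p∪q⁻ X₂ Y₂ in₂)

      disagreeing-row-avoids : ∀ {i} → τ₁ i ≢ τ₂ i → ∀ j → ¬ OnX (vv i j)
      disagreeing-row-avoids {i} τ≢ j inX =
        let W , W∈ , c , wc∈W , occ = guarded i
            j′ , adj = occurrence-adjacent occ
            whole-row = row-confined OnX OnY OnX-apart-OnY (disagreeing-row-covered τ≢) inX
        in OnX-apart W∈ (whole-row j′) wc∈W (Adj-sym adj)

      private
        X₁∩X₂∪Y₂⊆X₂ : ∀ {x} → x ∈ X₁ → x ∈ X₂ ∪ Y₂ → x ∈ X₂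
        X₁∩X₂∪Y₂⊆X₂ x∈X₁ x∈S₂ with x∈p∪q⁻ X₂ Y₂ x∈S₂
        ... | inj₁ x∈X₂ = x∈X₂
        ... | inj₂ x∈Y₂ = ⊥-elim (disjoint X₁∈ Y₂∈ x∈X₁ x∈Y₂)

      false-literal-stays-false : ∀ {c i j n} → ww c ∈ X₁ → Edge (ww c) (vv i j) →
                                  toℕ j ≡ 2 * toℕ c + b2n n → τ₁ i ≢ n → τ₂ i ≢ n
      false-literal-stays-false {c} wc∈X₁ edge e τ₁≢n refl
        with x∈p∪q⁻ X₂ Y₂ (canonical-row can₂ (toℕ c) e)
      ... | inj₁ v∈X₂ = disagreeing-row-avoids τ₁≢n _ (inj₂ v∈X₂)
      ... | inj₂ v∈Y₂ = apart X₁∈ Y₂∈ wc∈X₁ v∈Y₂ (inj₁ edge)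

      useful-⊆ : X₁ ⊆ X₂
      useful-⊆ {x} x∈X₁ with proj₁ (can₁ x) (x∈p∪q⁺ (inj₁ x∈X₁))
      ... | inV i j m e with τ₁ i Bool.≟ τ₂ i
      ...   | yes τ≡ = X₁∩X₂∪Y₂⊆X₂ x∈X₁ (canonical-row can₂ m (subst (λ t → toℕ j ≡ 2 * m + b2n t) τ≡ e))
      ...   | no τ≢ = ⊥-elim (disagreeing-row-avoids τ≢ j (inj₁ x∈X₁))
      useful-⊆ {x} x∈X₁ | inW c a-false b-false =
        X₁∩X₂∪Y₂⊆X₂ x∈X₁ (proj₂ (can₂ (ww c)) (inW c
          (false-literal-stays-false x∈X₁ (edgeA c _ (toℕ-slot c _)) (toℕ-slot c _) a-false)
          (false-literal-stays-false x∈X₁ (edgeB c _ (toℕ-slot c _)) (toℕ-slot c _) b-false)))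

    at-most-one-useful : AtMostOne (Useful 𝒳 𝒴)
    at-most-one-useful S T (S∈ , Y , Y∈ , τ , can) (T∈ , Y′ , Y′∈ , τ′ , can′) =
      ⊆-antisym (useful-⊆ S∈ Y∈ can T∈ Y′∈ can′) (useful-⊆ T∈ Y′∈ can′ S∈ Y∈ can)

  row-guarded? : ∀ W i → Dec (RowGuardedBy W i)
  row-guarded? W i = any? (λ c → (ww c ∈? W) ×-dec ((a (enum c) ≟ i) ⊎-dec (b (enum c) ≟ i)))

  module _ (surj : Surjective _≡_ _≡_ enum) {ρ I} (canI : IsCanonical ρ I) where

    -- The clause (x, y, ¬ρ(x), ¬ρ(y)) is falsified by ρ in both literals, so its vertex lies in I_ρ.
    joining-clause< : ∀ {x y} → x < y → ∃[ c ] (ww c ∈ I × a (enum c) ≡ x × b (enum c) ≡ y)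
    joining-clause< {x} {y} x<y =
      c , proj₂ (canI (ww c)) (inW c (falsified a na refl) (falsified b nb refl)) ,
      cong a enum-c , cong b enum-c
      where
      C = clause x y x<y (not (ρ x)) (not (ρ y))
      c = proj₁ (surj C)
      enum-c = proj₂ (surj C) refl
      falsified : ∀ (v : Clause k → Fin k) (n : Clause k → Bool) →
                  n C ≡ not (ρ (v C)) → ρ (v (enum c)) ≢ n (enum c)
      falsified v n n≡ = subst (λ D → ρ (v D) ≢ n D) (sym enum-c) (λ ρ≡ → not-¬ refl (trans ρ≡ n≡))

    joining-clause : ∀ {x y} → x ≢ y → ∃[ c ] (ww c ∈ I × Occurs c x × Occurs c y)
    joining-clause {x} {y} x≢y with <-cmp x y
    ... | tri< x<y _ _ = let c , wc∈I , a≡x , b≡y = joining-clause< x<y in c , wc∈I , inj₁ a≡x , inj₂ b≡y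
    ... | tri≈ _ x≡y _ = ⊥-elim (x≢y x≡y)
    ... | tri> _ _ y<x = let c , wc∈I , a≡y , b≡x = joining-clause< y<x in c , wc∈I , inj₂ b≡x , inj₁ a≡y

    some-side-guards-all-rows : (∀ y → ∃[ x ] x ≢ y) → ∀ {𝒜 ℬ A B} → A ∈F 𝒜 → B ∈F ℬ → A ∪ B ≡ I →
                                RowsGuardedBy 𝒜 ⊎ RowsGuardedBy ℬ
    some-side-guards-all-rows other {A = A} {B} A∈ B∈ refl with all? (row-guarded? A)
    ... | yes A-guards = inj₁ λ i → A , A∈ , A-guards i
    ... | no ¬A-guards = inj₂ λ i → B , B∈ , B-guards i
      where
      y₀-unguarded = ¬∀⟶∃¬ k _ (row-guarded? A) ¬A-guards
      y₀ = proj₁ y₀-unguarded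

      guards-with-y₀ : ∀ {x} → x ≢ y₀ → RowGuardedBy B x × RowGuardedBy B y₀
      guards-with-y₀ x≢y₀ with joining-clause x≢y₀
      ... | c , wc∈I , occ-x , occ-y₀ with x∈p∪q⁻ A B wc∈I
      ...   | inj₁ wc∈A = ⊥-elim (proj₂ y₀-unguarded (c , wc∈A , occ-y₀))
      ...   | inj₂ wc∈B = (c , wc∈B , occ-x) , (c , wc∈B , occ-y₀)

      B-guards : ∀ i → RowGuardedBy B i
      B-guards i with i ≟ y₀
      ... | yes refl = proj₂ (guards-with-y₀ (proj₂ (other y₀)))
      ... | no i≢y₀ = proj₁ (guards-with-y₀ i≢y₀)

lemma3p2 : (k : ℕ) → 1 ≤ k → (enum : Fin (q k) → Clause k) → Bijective _≡_ _≡_ enum →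
    (𝒜 ℬ : G.Family k enum) → G.Rectangle k enum 𝒜 ℬ →
    (∃[ ρ ] ∃[ I ] (G.IsCanonical k enum ρ I × G.Contains k enum 𝒜 ℬ I)) →
    G.AtMostOne k enum (G.UsefulA k enum 𝒜 ℬ) ⊎ G.AtMostOne k enum (G.UsefulB k enum 𝒜 ℬ)
lemma3p2 zero () _ _ _ _ _ _
-- G₁ has no clauses, hence no vertices, and the only vertex set is empty.
lemma3p2 (suc zero) _ _ _ _ _ _ _ = inj₁ λ { [] [] _ _ → refl }
lemma3p2 k@(suc (suc _)) _ enum (_ , surj) 𝒜 ℬ (_ , _ , sep) (ρ , I , canI , A , B , A∈ , B∈ , A∪B≡I)
  with some-side-guards-all-rows k enum surj canI another A∈ B∈ A∪B≡I
... | inj₁ 𝒜-guards =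
  inj₂ (at-most-one-UsefulB k enum (at-most-one-useful k enum (Separated-sym k enum sep) 𝒜-guards))
... | inj₂ ℬ-guards = inj₁ (at-most-one-useful k enum sep ℬ-guards)
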